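{- Let $S$ be a commutative periodic semigroup and $R$ a commutative unitary ring. Suppose that ${\rm St}(e)\subseteq E(S)$ for every $e\in E(S)$. Then $I(S)\le d(S,R)+1$.
   Context: Semigroups are commutative, written additively; $E(S)$ is the set of idempotents of $S$; ${\rm St}(e)=\{c\in S:c+e=e\}$. For periodic $x$ (i.e. $\langle x\rangle=\{mx:m\ge1\}$ finite), $e(x)$ is the unique idempotent in $\langle x\rangle$. $R[X;S]$ is the semigroup ring with basis $\{X^s\}$ and $X^sX^t=X^{s+t}$. $d(S,R)$ is the supremum of all $\ell\in\mathbb N\cup\{\infty\}$ such that some sequence $s_1\cdots s_\ell$ over $S$ satisfies $\prod_i(X^{s_i}-a_iX^{e(s_i)})\ne0$ for all $a_1,\dots,a_\ell\in R\setminus\{0\}$. The Erdős–Burgess constant $I(S)$ is the smallest $\ell\in\mathbb N\cup\{\infty\}$ such that every sequence over $S$ of length at least $\ell$ has a nonempty subsequence whose sum is an idempotent. -}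

module Defs where

open import Level using (Level; _⊔_)
open import Data.Nat as ℕ using (ℕ; zero; suc; _≤_; _<_)
open import Data.Fin using (Fin; zero; suc)
open import Data.Product using (Σ; ∃; ∃-syntax; _×_; _,_)
open import Data.List using (List; []; _∷_; map; concatMap)
open import Data.Unit.Polymorphic using (⊤)
open import Function using (_∘_)
open import Function.Definitions using (Injective)
open import Relation.Binary.PropositionalEquality using (_≡_)
open import Relation.Nullary using (¬_)
open import Relation.Binary.Construct.Closure.ReflexiveTransitive using (Star)
open import Data.List.Relation.Binary.Permutation.Propositional using (_↭_)
open import Algebra.Bundles using (CommutativeSemigroup; CommutativeRing)

module SemigroupNotions {c ℓ : Level} (S : CommutativeSemigroup c ℓ) where
  open CommutativeSemigroup S renaming (Carrier to A)

  -- rep m x = (m+1)·x = x + x + ... + x  (m+1 summands)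
  rep : ℕ → A → A
  rep zero    x = x
  rep (suc m) x = x ∙ rep m x

  _∈⟨_⟩ : A → A → Set (ℓ)
  y ∈⟨ x ⟩ = ∃[ m ] (y ≈ rep m x)

  IsIdempotent : A → Set ℓ
  IsIdempotent e = e ∙ e ≈ e

  -- ⟨x⟩ is finite: every multiple of x is among the first N multiples
  IsPeriodicElt : A → Set ℓ
  IsPeriodicElt x = ∃[ N ] ((m : ℕ) → ∃[ j ] (j < N × rep m x ≈ rep j x))

  IsPeriodic : Set (c ⊔ ℓ)
  IsPeriodic = (x : A) → IsPeriodicElt x

  StabilisersIdempotent : Set (c ⊔ ℓ)
  StabilisersIdempotent =
    (e : A) → IsIdempotent e → (c : A) → c ∙ e ≈ e → IsIdempotent c

  sumF : (n : ℕ) → (Fin (suc n) → A) → A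
  sumF zero    f = f zero
  sumF (suc n) f = f zero ∙ sumF n (f ∘ suc)

  -- a sequence T = t_0 ... t_{n-1} is idempotent-sum free if no nonempty
  -- subsequence (given by an injective choice of indices) sums to an idempotent
  IdempotentSumFree : (n : ℕ) → (Fin n → A) → Set ℓ
  IdempotentSumFree n T =
    (m : ℕ) (g : Fin (suc m) → Fin n) → Injective _≡_ _≡_ g →
    ¬ IsIdempotent (sumF m (T ∘ g))

  -- "I(S) > k": NOT every sequence of length ≥ k has a nonempty
  -- subsequence with idempotent sum, i.e. some idempotent-sum-free
  -- sequence of length ≥ k exists.
  ErdosBurgessGreaterThan : ℕ → Set (c ⊔ ℓ)
  ErdosBurgessGreaterThan k =
    ∃[ n ] (k ≤ n × Σ (Fin n → A) (IdempotentSumFree n))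

module SemigroupRing {c ℓ c' ℓ' : Level}
    (S : CommutativeSemigroup c ℓ) (R : CommutativeRing c' ℓ') where
  open CommutativeSemigroup S using (_∙_) renaming (Carrier to A; _≈_ to _≈S_)
  open CommutativeRing R using (_+_; _*_; -_; 0#; 1#) renaming (Carrier to K; _≈_ to _≈R_)
  open SemigroupNotions S

  -- a formal sum  Σ r X^s  as a list of (r , s)
  FS : Set (c ⊔ c')
  FS = List (K × A)

  mulFS : FS → FS → FS
  mulFS f g = concatMap (λ { (r , s) → map (λ { (r' , t) → (r * r' , s ∙ t) }) g }) f

  -- elementary moves that preserve the element of R[X;S] represented:
  -- reordering, merging two terms with equal exponents, deleting a term
  -- with zero coefficient
  data Step : FS → FS → Set (c ⊔ c' ⊔ ℓ ⊔ ℓ') where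
    perm  : ∀ {f g} → f ↭ g → Step f g
    merge : ∀ {r r' s s' f} → s ≈S s' →
            Step ((r , s) ∷ (r' , s') ∷ f) ((r + r' , s) ∷ f)
    drop  : ∀ {r s f} → r ≈R 0# → Step ((r , s) ∷ f) f

  IsZero : FS → Set (c ⊔ c' ⊔ ℓ ⊔ ℓ')
  IsZero f = Star Step f []

  factor : A → K → A → FS
  factor s a e = (1# , s) ∷ (- a , e) ∷ []

  prodFS : (n : ℕ) → (Fin (suc n) → FS) → FS
  prodFS zero    f = f zero
  prodFS (suc n) f = mulFS (f zero) (prodFS n (f ∘ suc))

  -- the sequence s_1 ... s_n satisfies: Π (X^{s_i} - a_i X^{e(s_i)}) ≠ 0
  -- for all nonzero a_i (e(s_i) = the idempotent of ⟨s_i⟩).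
  -- The empty product (n = 0) counts as admissible.
  Admissible : (n : ℕ) → (Fin n → A) → Set (c ⊔ c' ⊔ ℓ ⊔ ℓ')
  Admissible zero    s = ⊤
  Admissible (suc n) s =
    (a : Fin (suc n) → K) (e : Fin (suc n) → A) →
    ((i : Fin (suc n)) → ¬ (a i ≈R 0#)) →
    ((i : Fin (suc n)) → IsIdempotent (e i) × (e i ∈⟨ s i ⟩)) →
    ¬ IsZero (prodFS n (λ i → factor (s i) (a i) (e i)))

  -- "d(S,R) ≥ k"  (d is a supremum in ℕ ∪ {∞})
  dAtLeast : ℕ → Set (c ⊔ c' ⊔ ℓ ⊔ ℓ')
  dAtLeast k = ∃[ n ] (k ≤ n × Σ (Fin n → A) (Admissible n))

  -- I(S) ≤ d(S,R) + 1 in ℕ ∪ {∞}:  for all k, I(S) > k implies d(S,R)+1 > k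
  ErdosBurgess≤d+1 : Set (c ⊔ c' ⊔ ℓ ⊔ ℓ')
  ErdosBurgess≤d+1 = (k : ℕ) → ErdosBurgessGreaterThan k → dAtLeast k

{-# OPTIONS --safe #-}
module Submission where

-- Expanding Π (X^{t_i} − a_i X^{e_i}) over the subsets I of the indices gives the exponents
-- Σ_{i∈I} t_i + Σ_{i∉I} e_i.  If no nonempty subsequence of T has idempotent sum, only
-- I = everything yields σ = Σ t_i: were the complement J of I nonempty, then with
-- v = Σ_{i∈J} t_i the exponent being σ would give v + E = E for the idempotent E = Σ e_i,
-- so v ∈ St(E) ⊆ E(S).  Hence X^σ has coefficient 1, and the product vanishing would
-- force 1 = 0, contradicting a_i ≠ 0.

open import Defs
open import Level using (Level; _⊔_)
open import Algebra.Bundles using (CommutativeSemigroup; CommutativeRing)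
open import Data.Nat as ℕ using (zero; suc)
open import Data.Fin using (Fin; zero; suc; lift)
open import Data.Fin.Properties using (suc-injective; lift-injective)
open import Data.Bool using (Bool; true; false; if_then_else_)
open import Data.Bool.Properties using (if-eta)
open import Data.Vec using (Vec; []; _∷_; lookup)
open import Data.Vec.Relation.Unary.All as All using (All; []; _∷_)
open import Data.Product using (Σ; ∃-syntax; ∃₂; _×_; _,_; proj₁; proj₂)
open import Data.Sum using (_⊎_; inj₁; inj₂)
open import Data.List using ([]; _∷_; map; _++_)
open import Data.Empty using (⊥-elim)
open import Data.Unit.Polymorphic using (tt)
open import Function using (_∘_)
open import Function.Definitions using (Injective)
open import Relation.Binary.Definitions using (_Respects_)
open import Relation.Binary.PropositionalEquality using (_≡_; refl)
open import Relation.Nullary using (¬_; yes; no)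
open import Relation.Nullary.Decidable.Core using (¬¬-excluded-middle)
open import Relation.Binary.Construct.Closure.ReflexiveTransitive using (ε; _◅_)
open import Data.List.Relation.Binary.Permutation.Propositional as ↭ using (_↭_)
import Algebra.Properties.CommutativeSemigroup as CommutativeSemigroupProperties
import Relation.Binary.Reasoning.Setoid as SetoidReasoning

module MixedSums {c ℓ : Level} (S : CommutativeSemigroup c ℓ) where
  open SemigroupNotions S
  open CommutativeSemigroup S renaming (Carrier to A; refl to ≈-refl; sym to ≈-sym; trans to ≈-trans)
  open CommutativeSemigroupProperties S
  open SetoidReasoning setoid

  sumF-cong : ∀ n {X Y : Fin (suc n) → A} → (∀ i → X i ≈ Y i) → sumF n X ≈ sumF n Y
  sumF-cong zero    X≈Y = X≈Y zero
  sumF-cong (suc n) X≈Y = ∙-cong (X≈Y zero) (sumF-cong n (X≈Y ∘ suc))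

  sumF-∙ : ∀ n (X Y : Fin (suc n) → A) → sumF n (λ i → X i ∙ Y i) ≈ sumF n X ∙ sumF n Y
  sumF-∙ zero    X Y = ≈-refl
  sumF-∙ (suc n) X Y = begin
    (X zero ∙ Y zero) ∙ sumF n (λ i → X (suc i) ∙ Y (suc i))
      ≈⟨ ∙-congˡ (sumF-∙ n (X ∘ suc) (Y ∘ suc)) ⟩
    (X zero ∙ Y zero) ∙ (sumF n (X ∘ suc) ∙ sumF n (Y ∘ suc))
      ≈⟨ interchange _ _ _ _ ⟩
    (X zero ∙ sumF n (X ∘ suc)) ∙ (Y zero ∙ sumF n (Y ∘ suc)) ∎

  sumF-absorbed : ∀ n {X : Fin (suc n) → A} {e : A} →
    (∀ i → X i ∙ e ≈ e) → sumF n X ∙ e ≈ e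
  sumF-absorbed zero    X∙e≈e = X∙e≈e zero
  sumF-absorbed (suc n) X∙e≈e =
    ≈-trans (assoc _ _ _) (≈-trans (∙-congˡ (sumF-absorbed n (X∙e≈e ∘ suc))) (X∙e≈e zero))

  idempotent-absorbed-by-sumF : ∀ n {X : Fin (suc n) → A} →
    (∀ i → IsIdempotent (X i)) → ∀ i → X i ∙ sumF n X ≈ sumF n X
  idempotent-absorbed-by-sumF zero    X-idem zero    = X-idem zero
  idempotent-absorbed-by-sumF (suc n) X-idem zero    =
    ≈-trans (≈-sym (assoc _ _ _)) (∙-congʳ (X-idem zero))
  idempotent-absorbed-by-sumF (suc n) X-idem (suc i) =
    ≈-trans (x∙yz≈y∙xz _ _ _) (∙-congˡ (idempotent-absorbed-by-sumF n (X-idem ∘ suc) i))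

  sumF-idempotent : ∀ n {X : Fin (suc n) → A} →
    (∀ i → IsIdempotent (X i)) → IsIdempotent (sumF n X)
  sumF-idempotent n X-idem = sumF-absorbed n (idempotent-absorbed-by-sumF n X-idem)

  rep-+ : ∀ a b x → rep (suc (a ℕ.+ b)) x ≈ rep a x ∙ rep b x
  rep-+ zero    b x = ≈-refl
  rep-+ (suc a) b x = ≈-trans (∙-congˡ (rep-+ a b x)) (≈-sym (assoc _ _ _))

  idempotent∈⟨x⟩⇒x∙y≈e : ∀ {e x} → IsIdempotent e → e ∈⟨ x ⟩ → ∃[ y ] (x ∙ y ≈ e)
  idempotent∈⟨x⟩⇒x∙y≈e {e} {x} e-idem (p , e≈px) = rep (p ℕ.+ p) x , (begin
    rep (suc (p ℕ.+ p)) x  ≈⟨ rep-+ p p x ⟩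
    rep p x ∙ rep p x      ≈⟨ ∙-cong (≈-sym e≈px) (≈-sym e≈px) ⟩
    e ∙ e                  ≈⟨ e-idem ⟩
    e                      ∎)

  mix : ∀ {n} → Vec Bool n → (Fin n → A) → (Fin n → A) → Fin n → A
  mix b X Y i = if lookup b i then X i else Y i

  mix-same : ∀ {n} (b : Vec Bool n) X i → mix b X X i ≡ X i
  mix-same b X i = if-eta (lookup b i)

  mix-allTrue : ∀ {n} {b : Vec Bool n} → All (_≡ true) b → ∀ X Y i → mix b X Y i ≡ X i
  mix-allTrue (refl ∷ _)    X Y zero    = refl
  mix-allTrue (_ ∷ allTrue) X Y (suc i) = mix-allTrue allTrue (X ∘ suc) (Y ∘ suc) i

  sumF-mix-allTrue : ∀ n {b : Vec Bool (suc n)} → All (_≡ true) b →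
    ∀ X Y → sumF n (mix b X Y) ≈ sumF n X
  sumF-mix-allTrue n allTrue X Y = sumF-cong n (reflexive ∘ mix-allTrue allTrue X Y)

  mix-∙-≈ : ∀ {n} (b : Vec Bool n) {X Y X′ Y′ Z : Fin n → A} →
    (∀ i → X i ∙ X′ i ≈ Z i) → (∀ i → Y i ∙ Y′ i ≈ Z i) →
    ∀ i → mix b X Y i ∙ mix b X′ Y′ i ≈ Z i
  mix-∙-≈ b X∙X′≈Z Y∙Y′≈Z i with lookup b i
  ... | true  = X∙X′≈Z i
  ... | false = Y∙Y′≈Z i

  -- g lists the positions where b is false: in a sum over b, the entries there can be
  -- traded against the sum over g.  Phrased with products so no empty sum is needed.
  Exchanges : ∀ {m n} → Vec Bool (suc n) → (Fin (suc m) → Fin (suc n)) → Set (c ⊔ ℓ)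
  Exchanges {m} {n} b g = ∀ X Y Z →
    sumF n (mix b X Y) ∙ sumF m (Z ∘ g) ≈ sumF n (mix b X Z) ∙ sumF m (Y ∘ g)

  const-injective : ∀ {n} (k : Fin n) → Injective _≡_ _≡_ (λ (_ : Fin 1) → k)
  const-injective k {zero} {zero} _ = refl

  allTrue⊎exchanges : ∀ n (b : Vec Bool (suc n)) → All (_≡ true) b ⊎
    ∃[ m ] Σ (Fin (suc m) → Fin (suc n)) λ g → Injective _≡_ _≡_ g × Exchanges b g
  allTrue⊎exchanges zero (true ∷ [])  = inj₁ (refl ∷ [])
  allTrue⊎exchanges zero (false ∷ []) =
    inj₂ (0 , (λ _ → zero) , const-injective zero , λ X Y Z → comm (Y zero) (Z zero))
  allTrue⊎exchanges (suc n) (true ∷ b) with allTrue⊎exchanges n b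
  ... | inj₁ allTrue = inj₁ (refl ∷ allTrue)
  ... | inj₂ (m , g , g-inj , exch) =
    inj₂ (m , suc ∘ g , g-inj ∘ suc-injective , λ X Y Z →
      ≈-trans (assoc _ _ _) (≈-trans (∙-congˡ (exch (X ∘ suc) (Y ∘ suc) (Z ∘ suc)))
        (≈-sym (assoc _ _ _))))
  allTrue⊎exchanges (suc n) (false ∷ b) with allTrue⊎exchanges n b
  ... | inj₁ allTrue =
    inj₂ (0 , (λ _ → zero) , const-injective zero , λ X Y Z → begin
      (Y zero ∙ sumF n (mix b (X ∘ suc) (Y ∘ suc))) ∙ Z zero
        ≈⟨ ∙-congʳ (∙-congˡ (sumF-mix-allTrue n allTrue (X ∘ suc) (Y ∘ suc))) ⟩
      (Y zero ∙ sumF n (X ∘ suc)) ∙ Z zero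
        ≈⟨ xy∙z≈zy∙x _ _ _ ⟩
      (Z zero ∙ sumF n (X ∘ suc)) ∙ Y zero
        ≈⟨ ∙-congʳ (∙-congˡ (≈-sym (sumF-mix-allTrue n allTrue (X ∘ suc) (Z ∘ suc)))) ⟩
      (Z zero ∙ sumF n (mix b (X ∘ suc) (Z ∘ suc))) ∙ Y zero ∎)
  ... | inj₂ (m , g , g-inj , exch) =
    inj₂ (suc m , lift 1 g , lift-injective g g-inj 1 , λ X Y Z → begin
      (Y zero ∙ sumF n (mix b (X ∘ suc) (Y ∘ suc))) ∙ (Z zero ∙ sumF m (Z ∘ suc ∘ g))
        ≈⟨ interchange _ _ _ _ ⟩
      (Y zero ∙ Z zero) ∙ (sumF n (mix b (X ∘ suc) (Y ∘ suc)) ∙ sumF m (Z ∘ suc ∘ g))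
        ≈⟨ ∙-cong (comm _ _) (exch (X ∘ suc) (Y ∘ suc) (Z ∘ suc)) ⟩
      (Z zero ∙ Y zero) ∙ (sumF n (mix b (X ∘ suc) (Z ∘ suc)) ∙ sumF m (Y ∘ suc ∘ g))
        ≈⟨ interchange _ _ _ _ ⟩
      (Z zero ∙ sumF n (mix b (X ∘ suc) (Z ∘ suc))) ∙ (Y zero ∙ sumF m (Y ∘ suc ∘ g)) ∎)

  -- With W = Σ (y_i if b_i else e_i), where t_i + y_i = e_i, one has E = s + W; the
  -- exchange turns v + s into f + s, and f + E = E as f is a sum of the e_i.
  mixedSum≈sum⇒allTrue : StabilisersIdempotent → ∀ n (T e : Fin (suc n) → A) →
    IdempotentSumFree (suc n) T → (∀ i → IsIdempotent (e i) × e i ∈⟨ T i ⟩) →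
    ∀ b → sumF n (mix b T e) ≈ sumF n T → All (_≡ true) b
  mixedSum≈sum⇒allTrue stab n T e sumFree e-spec b s≈ΣT with allTrue⊎exchanges n b
  ... | inj₁ allTrue = allTrue
  ... | inj₂ (m , g , g-inj , exch) = ⊥-elim (sumFree m g g-inj (stab E E-idem v v∙E≈E))
    where
    v f s E : A
    v = sumF m (T ∘ g)
    f = sumF m (e ∘ g)
    s = sumF n (mix b T e)
    E = sumF n e

    e-idem : ∀ i → IsIdempotent (e i)
    e-idem = proj₁ ∘ e-spec

    E-idem : IsIdempotent E
    E-idem = sumF-idempotent n e-idem

    T∙y≈e : ∀ i → ∃[ y ] (T i ∙ y ≈ e i)
    T∙y≈e i = idempotent∈⟨x⟩⇒x∙y≈e (e-idem i) (proj₂ (e-spec i))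

    W : A
    W = sumF n (mix b (proj₁ ∘ T∙y≈e) e)

    E≈s∙W : E ≈ s ∙ W
    E≈s∙W = ≈-trans (sumF-cong n (≈-sym ∘ mix-∙-≈ b (proj₂ ∘ T∙y≈e) e-idem)) (sumF-∙ n _ _)

    s∙v≈s∙f : s ∙ v ≈ s ∙ f
    s∙v≈s∙f = begin
      s ∙ v                   ≈⟨ exch T e T ⟩
      sumF n (mix b T T) ∙ f  ≈⟨ ∙-congʳ (sumF-cong n (reflexive ∘ mix-same b T)) ⟩
      sumF n T ∙ f            ≈⟨ ∙-congʳ (≈-sym s≈ΣT) ⟩
      s ∙ f                   ∎

    v∙E≈E : v ∙ E ≈ E
    v∙E≈E = begin
      v ∙ E        ≈⟨ ∙-congˡ E≈s∙W ⟩
      v ∙ (s ∙ W)  ≈⟨ x∙yz≈yx∙z _ _ _ ⟩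
      (s ∙ v) ∙ W  ≈⟨ ∙-congʳ s∙v≈s∙f ⟩
      (s ∙ f) ∙ W  ≈⟨ xy∙z≈y∙xz _ _ _ ⟩
      f ∙ (s ∙ W)  ≈⟨ ∙-congˡ (≈-sym E≈s∙W) ⟩
      f ∙ E        ≈⟨ sumF-absorbed m (idempotent-absorbed-by-sumF n e-idem ∘ g) ⟩
      E            ∎

module Coefficients {c ℓ c′ ℓ′ : Level}
    (S : CommutativeSemigroup c ℓ) (R : CommutativeRing c′ ℓ′) where
  open SemigroupNotions S
  open SemigroupRing S R
  open MixedSums S using (mix; mixedSum≈sum⇒allTrue)
  open CommutativeSemigroup S using (_∙_) renaming (Carrier to A; _≈_ to _≈S_; refl to ≈S-refl; sym to ≈S-sym; trans to ≈S-trans)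
  open CommutativeRing R hiding (zero) renaming (Carrier to K; refl to ≈-refl; sym to ≈-sym; trans to ≈-trans)
  open SetoidReasoning setoid

  -- A relation rather than a function, since P need not be decidable.
  data Coeff {p} (P : A → Set p) : FS → K → Set (c ⊔ c′ ⊔ p) where
    []    : Coeff P [] 0#
    count : ∀ {r s f x} → P s → Coeff P f x → Coeff P ((r , s) ∷ f) (r + x)
    skip  : ∀ {r s f x} → ¬ P s → Coeff P f x → Coeff P ((r , s) ∷ f) x

  module _ {p} {P : A → Set p} where

    Coeff-exists : ∀ f → ¬ ¬ (∃[ x ] Coeff P f x)
    Coeff-exists []            k = k (0# , [])
    Coeff-exists ((r , s) ∷ f) k = Coeff-exists f λ { (x , co) →
      ¬¬-excluded-middle λ { (yes Ps) → k (r + x , count Ps co)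
                           ; (no ¬Ps) → k (x , skip ¬Ps co) } }

    Coeff-++ : ∀ f g {x} → Coeff P (f ++ g) x →
      ∃₂ λ y z → Coeff P f y × Coeff P g z × x ≈ y + z
    Coeff-++ []      g {x} co = 0# , x , [] , co , ≈-sym (+-identityˡ x)
    Coeff-++ (_ ∷ f) g (count {r = r} {x = x} Ps co) with Coeff-++ f g co
    ... | y , z , co-f , co-g , x≈y+z =
      r + y , z , count Ps co-f , co-g , ≈-trans (+-congˡ x≈y+z) (≈-sym (+-assoc r y z))
    Coeff-++ (_ ∷ f) g (skip ¬Ps co) with Coeff-++ f g co
    ... | y , z , co-f , co-g , x≈y+z = y , z , skip ¬Ps co-f , co-g , x≈y+z

    module _ (P-resp : P Respects _≈S_) where

      Coeff-↭ : ∀ {f g x} → f ↭ g → Coeff P f x → ∃[ y ] (Coeff P g y × x ≈ y)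
      Coeff-↭ ↭.refl co = _ , co , ≈-refl
      Coeff-↭ (↭.prep _ f↭g) (count Ps co) with Coeff-↭ f↭g co
      ... | y , co′ , x≈y = _ , count Ps co′ , +-congˡ x≈y
      Coeff-↭ (↭.prep _ f↭g) (skip ¬Ps co) with Coeff-↭ f↭g co
      ... | y , co′ , x≈y = _ , skip ¬Ps co′ , x≈y
      Coeff-↭ (↭.swap _ _ f↭g) (count {r = r₁} Ps₁ (count {r = r₂} {x = x} Ps₂ co))
        with Coeff-↭ f↭g co
      ... | y , co′ , x≈y = _ , count Ps₂ (count Ps₁ co′) , (begin
        r₁ + (r₂ + x)  ≈⟨ ≈-sym (+-assoc r₁ r₂ x) ⟩
        (r₁ + r₂) + x  ≈⟨ +-cong (+-comm r₁ r₂) x≈y ⟩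
        (r₂ + r₁) + y  ≈⟨ +-assoc r₂ r₁ y ⟩
        r₂ + (r₁ + y)  ∎)
      Coeff-↭ (↭.swap _ _ f↭g) (count Ps₁ (skip ¬Ps₂ co)) with Coeff-↭ f↭g co
      ... | y , co′ , x≈y = _ , skip ¬Ps₂ (count Ps₁ co′) , +-congˡ x≈y
      Coeff-↭ (↭.swap _ _ f↭g) (skip ¬Ps₁ (count Ps₂ co)) with Coeff-↭ f↭g co
      ... | y , co′ , x≈y = _ , count Ps₂ (skip ¬Ps₁ co′) , +-congˡ x≈y
      Coeff-↭ (↭.swap _ _ f↭g) (skip ¬Ps₁ (skip ¬Ps₂ co)) with Coeff-↭ f↭g co
      ... | y , co′ , x≈y = _ , skip ¬Ps₂ (skip ¬Ps₁ co′) , x≈y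
      Coeff-↭ (↭.trans f↭g g↭h) co with Coeff-↭ f↭g co
      ... | y , co′ , x≈y with Coeff-↭ g↭h co′
      ... | z , co″ , y≈z = z , co″ , ≈-trans x≈y y≈z

      Coeff-Step : ∀ {f g x} → Step f g → Coeff P f x → ∃[ y ] (Coeff P g y × x ≈ y)
      Coeff-Step (perm f↭g) co = Coeff-↭ f↭g co
      Coeff-Step (merge {r = r} {r′} s≈s′) (count Ps (count {x = x} _ co)) =
        _ , count Ps co , ≈-sym (+-assoc r r′ x)
      Coeff-Step (merge s≈s′) (count Ps (skip ¬Ps′ co)) = ⊥-elim (¬Ps′ (P-resp s≈s′ Ps))
      Coeff-Step (merge s≈s′) (skip ¬Ps (count Ps′ co)) =
        ⊥-elim (¬Ps (P-resp (≈S-sym s≈s′) Ps′))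
      Coeff-Step (merge s≈s′) (skip ¬Ps (skip _ co)) = _ , skip ¬Ps co , ≈-refl
      Coeff-Step (drop {r = r} r≈0) (count {x = x} _ co) =
        _ , co , ≈-trans (+-congʳ r≈0) (+-identityˡ x)
      Coeff-Step (drop r≈0) (skip _ co) = _ , co , ≈-refl

      Coeff-IsZero : ∀ {f x} → IsZero f → Coeff P f x → x ≈ 0#
      Coeff-IsZero ε              []  = ≈-refl
      Coeff-IsZero (step ◅ steps) co with Coeff-Step step co
      ... | y , co′ , x≈y = ≈-trans x≈y (Coeff-IsZero steps co′)

    Coeff-map : ∀ (h : K × A → K × A) r s → (∀ r′ t → h (r′ , t) ≡ (r * r′ , s ∙ t)) →
      ∀ g {x} → Coeff P (map h g) x → ∃[ y ] (Coeff (P ∘ (s ∙_)) g y × x ≈ r * y)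
    Coeff-map h r s h-def [] [] = 0# , [] , ≈-sym (zeroʳ r)
    Coeff-map h r s h-def ((r′ , t) ∷ g) co with h (r′ , t) | h-def r′ t
    Coeff-map h r s h-def ((r′ , t) ∷ g) (count Ps co) | _ | refl with Coeff-map h r s h-def g co
    ... | y , co′ , x≈ry = r′ + y , count Ps co′ , ≈-trans (+-congˡ x≈ry) (≈-sym (distribˡ r r′ y))
    Coeff-map h r s h-def ((r′ , t) ∷ g) (skip ¬Ps co) | _ | refl with Coeff-map h r s h-def g co
    ... | y , co′ , x≈ry = y , skip ¬Ps co′ , x≈ry

  Coeff-factor-mul : ∀ {p} {P : A → Set p} s a e g {x} → Coeff P (mulFS (factor s a e) g) x →
    ∃₂ λ y z → Coeff (P ∘ (s ∙_)) g y × Coeff (P ∘ (e ∙_)) g z × x ≈ 1# * y + - a * z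
  Coeff-factor-mul s a e g co with Coeff-++ _ _ co
  ... | x₁ , x₂ , co₁ , co₂ , x≈x₁+x₂ with Coeff-++ _ [] co₂
  ... | x₃ , _ , co₃ , [] , x₂≈x₃+0
    with Coeff-map _ 1# s (λ _ _ → refl) g co₁ | Coeff-map _ (- a) e (λ _ _ → refl) g co₃
  ... | y , co-y , x₁≈1y | z , co-z , x₃≈-az = y , z , co-y , co-z ,
    ≈-trans x≈x₁+x₂ (+-cong x₁≈1y (≈-trans x₂≈x₃+0 (≈-trans (+-identityʳ x₃) x₃≈-az)))

  1*y+-a*z≈u : ∀ a {y z u} → y ≈ u → z ≈ 0# → 1# * y + - a * z ≈ u
  1*y+-a*z≈u a {y} {z} {u} y≈u z≈0 = begin
    1# * y + - a * z   ≈⟨ +-cong (*-identityˡ y) (*-congˡ z≈0) ⟩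
    y + - a * 0#       ≈⟨ +-cong y≈u (zeroʳ (- a)) ⟩
    u + 0#             ≈⟨ +-identityʳ u ⟩
    u                  ∎

  expansion : ∀ m → (Fin (suc m) → A) → (Fin (suc m) → K) → (Fin (suc m) → A) → FS
  expansion m T a e = prodFS m (λ i → factor (T i) (a i) (e i))

  Coeff-expansion-≈0 : ∀ {p} m (T : Fin (suc m) → A) a e {P : A → Set p} →
    (∀ b → ¬ P (sumF m (mix b T e))) → ∀ {x} → Coeff P (expansion m T a e) x → x ≈ 0#
  Coeff-expansion-≈0 zero T a e ¬P (count Ps _)          = ⊥-elim (¬P (true ∷ []) Ps)
  Coeff-expansion-≈0 zero T a e ¬P (skip _ (count Ps _)) = ⊥-elim (¬P (false ∷ []) Ps)
  Coeff-expansion-≈0 zero T a e ¬P (skip _ (skip _ []))  = ≈-refl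
  Coeff-expansion-≈0 (suc m) T a e ¬P co
    with Coeff-factor-mul (T zero) (a zero) (e zero) (expansion m (T ∘ suc) (a ∘ suc) (e ∘ suc)) co
  ... | y , z , co-y , co-z , x≈ = ≈-trans x≈ (1*y+-a*z≈u (a zero)
    (Coeff-expansion-≈0 m (T ∘ suc) (a ∘ suc) (e ∘ suc) (¬P ∘ (true ∷_)) co-y)
    (Coeff-expansion-≈0 m (T ∘ suc) (a ∘ suc) (e ∘ suc) (¬P ∘ (false ∷_)) co-z))

  Coeff-expansion-≈1 : ∀ {p} m (T : Fin (suc m) → A) a e {P : A → Set p} →
    P (sumF m T) → (∀ b → P (sumF m (mix b T e)) → All (_≡ true) b) →
    ∀ {x} → Coeff P (expansion m T a e) x → x ≈ 1#
  Coeff-expansion-≈1 zero T a e PT onlyTrue (skip ¬PT _) = ⊥-elim (¬PT PT)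
  Coeff-expansion-≈1 zero T a e PT onlyTrue (count _ (count Pe _)) with onlyTrue (false ∷ []) Pe
  ... | () ∷ []
  Coeff-expansion-≈1 zero T a e PT onlyTrue (count _ (skip _ [])) = +-identityʳ 1#
  Coeff-expansion-≈1 (suc m) T a e PT onlyTrue co
    with Coeff-factor-mul (T zero) (a zero) (e zero) (expansion m (T ∘ suc) (a ∘ suc) (e ∘ suc)) co
  ... | y , z , co-y , co-z , x≈ = ≈-trans x≈ (1*y+-a*z≈u (a zero)
    (Coeff-expansion-≈1 m (T ∘ suc) (a ∘ suc) (e ∘ suc) PT (λ b → All.tail ∘ onlyTrue (true ∷ b)) co-y)
    (Coeff-expansion-≈0 m (T ∘ suc) (a ∘ suc) (e ∘ suc) (λ b → (λ { (() ∷ _) }) ∘ onlyTrue (false ∷ b)) co-z))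

  idempotentSumFree⇒admissible : StabilisersIdempotent →
    ∀ n T → IdempotentSumFree n T → Admissible n T
  idempotentSumFree⇒admissible stab zero    T sumFree = tt
  idempotentSumFree⇒admissible stab (suc n) T sumFree a e a≉0 e-spec isZero =
    Coeff-exists (expansion n T a e) λ (x , co) → a≉0 zero (begin
      a zero       ≈⟨ *-identityʳ (a zero) ⟨
      a zero * 1#  ≈⟨ *-congˡ (≈-trans (≈-sym (x≈1 co)) (x≈0 co)) ⟩
      a zero * 0#  ≈⟨ zeroʳ (a zero) ⟩
      0#           ∎)
    where
    P : A → Set ℓ
    P s = s ≈S sumF n T

    P-resp : P Respects _≈S_
    P-resp s≈t Ps = ≈S-trans (≈S-sym s≈t) Ps

    x≈1 : ∀ {x} → Coeff P (expansion n T a e) x → x ≈ 1#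
    x≈1 = Coeff-expansion-≈1 n T a e ≈S-refl (mixedSum≈sum⇒allTrue stab n T e sumFree e-spec)

    x≈0 : ∀ {x} → Coeff P (expansion n T a e) x → x ≈ 0#
    x≈0 = Coeff-IsZero P-resp isZero

proposition5p1 : {c ℓ c' ℓ' : Level}
    (S : CommutativeSemigroup c ℓ) (R : CommutativeRing c' ℓ') →
    SemigroupNotions.IsPeriodic S →
    SemigroupNotions.StabilisersIdempotent S →
    SemigroupRing.ErdosBurgess≤d+1 S R
proposition5p1 S R _ stab k (n , k≤n , T , sumFree) =
  n , k≤n , T , Coefficients.idempotentSumFree⇒admissible S R stab n T sumFree
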